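{- Let $\Pi\le\Gamma$ be a subgroup of order $2$ that fixes $S$ setwise, let $\Delta$ be the restriction of $\Pi$ to $R\cup C$, and let $\mathcal{F}$ be a one-factorization of $K_{n,n}$ with $\Delta\le\Phi_{\mathcal{F}}$ that is compatible with $\Pi$. Then there are exactly $|\Psi_\Pi|$ bijections $f:S\to\mathcal{F}$ such that $(\mathcal{F},f)$ agrees with $\Pi$.
   Context: $R,C,S$ are pairwise disjoint $n$-element sets. $\Gamma$ is the group of permutations of $R\cup C\cup S$ preserving the partition $\{R,C,S\}$. $K_{n,n}$ is the complete bipartite graph on $R\cup C$ with bipartition $\{R,C\}$; $\Phi$ is the group of permutations of $R\cup C$ preserving $\{R,C\}$, acting on spanning subgraphs and one-factorizations via vertices; $\Phi_{\mathcal{F}}$ is the stabilizer of $\mathcal{F}$. For $\delta\in\Delta$ let $\bar\delta$ be the permutation of $R\cup C\cup\mathcal{F}$ (disjoint union) induced by $\delta$ on $R\cup C$ and on $\mathcal{F}$, $\bar\Delta=\{\bar\delta:\delta\in\Delta\}$; for a bijection $f:S\to\mathcal{F}$ let $\bar f$ extend $f$ by the identity on $R\cup C$. $(\mathcal{F},f)$ agrees with $\Pi$ if $\{\bar f^{ -1}\bar\delta\bar f:\delta\in\Delta\}=\Pi$; $\mathcal{F}$ is compatible with $\Pi$ if some bijection $f$ makes $(\mathcal{F},f)$ agree with $\Pi$. $\Psi$ is the group of permutations of $R\cup C\cup S$ fixing $R\cup C$ pointwise, and $\Psi_\Pi=\{\psi\in\Psi:\psi\Pi\psi^{ -1}=\Pi\}$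 is the normalizer of $\Pi$ in $\Psi$. -}

module Defs where

open import Level using (0ℓ)
open import Data.Nat using (ℕ)
open import Data.Fin using (Fin)
open import Data.Product using (Σ; ∃; ∃-syntax; ∃!; _×_; _,_; proj₁; proj₂)
open import Data.Sum using (_⊎_; inj₁; inj₂)
open import Relation.Binary.PropositionalEquality using (_≡_; refl; sym; trans)
open import Relation.Binary.Bundles using (Setoid)
open import Function.Bundles using (_↔_; Inverse)
open import Function.Definitions using (Bijective)

-- The ground sets.  R, C, S are n-element sets; R ∪ C is modelled as
-- Side × Fin n (side R or C), and R ∪ C ∪ S as (R ∪ C) ⊎ S with S = Fin n.

data Side : Set where
  R C : Side

V : ℕ → Set
V n = Side × Fin n

Pt : ℕ → Set
Pt n = V n ⊎ Fin n

data Part : Set where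
  partR partC partS : Part

part : ∀ {n} → Pt n → Part
part (inj₁ (R , _)) = partR
part (inj₁ (C , _)) = partC
part (inj₂ _)       = partS

Perm : Set → Set
Perm A = A ↔ A

InΓ : ∀ {n} → (Pt n → Pt n) → Set
InΓ g = ∀ x y → (part x ≡ part y → part (g x) ≡ part (g y))
              × (part (g x) ≡ part (g y) → part x ≡ part y)

-- Π = {id, π} : the subgroup generated by the involution π.
-- Membership of a map h : Pt n → Pt n in Π (up to pointwise equality).
InΠ : ∀ {n} → Perm (Pt n) → (Pt n → Pt n) → Set
InΠ π h = (∀ x → h x ≡ x) ⊎ (∀ x → h x ≡ Inverse.to π x)

FixesS : ∀ {n} → (Pt n → Pt n) → Set
FixesS g = (∀ s → ∃[ s' ] g (inj₂ s) ≡ inj₂ s')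
         × (∀ s → ∃[ s' ] g (inj₂ s') ≡ inj₂ s)

InΔ : ∀ {n} → Perm (Pt n) → (V n → V n) → Set
InΔ {n} π δ = ∃[ g ] InΠ π g × (∀ (v : V n) → g (inj₁ v) ≡ inj₁ (δ v))

-- Spanning subgraphs of K_{n,n}: H r c means the edge {(R,r),(C,c)} is in H.

Subgraph : ℕ → Set₁
Subgraph n = Fin n → Fin n → Set

SameEdges : ∀ {n} → Subgraph n → Subgraph n → Set
SameEdges H K = ∀ r c → (H r c → K r c) × (K r c → H r c)

UPairEq : {A : Set} → A → A → A → A → Set
UPairEq a b x y = (a ≡ x × b ≡ y) ⊎ (a ≡ y × b ≡ x)

img : ∀ {n} → (V n → V n) → Subgraph n → Subgraph n
img δ H r' c' = ∃[ r ] ∃[ c ] H r c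
  × UPairEq (δ (R , r)) (δ (C , c)) (R , r') (C , c')

IsOneFactor : ∀ {n} → Subgraph n → Set
IsOneFactor H = (∀ r → ∃! _≡_ (λ c → H r c)) × (∀ c → ∃! _≡_ (λ r → H r c))

-- A one-factorization F is given as a family fac : I → Subgraph n of
-- pairwise distinct one-factors, F = { fac i | i ∈ I }, such that every
-- edge of K_{n,n} lies in exactly one member of F.
IsOneFactorization : ∀ {n} {I : Set} → (I → Subgraph n) → Set
IsOneFactorization fac =
    (∀ i → IsOneFactor (fac i))
  × (∀ r c → ∃! _≡_ (λ i → fac i r c))
  × (∀ i j → SameEdges (fac i) (fac j) → i ≡ j)

InΦ : ∀ {n} → (V n → V n) → Set
InΦ δ = Bijective _≡_ _≡_ δ
      × (∀ u v → (proj₁ u ≡ proj₁ v → proj₁ (δ u) ≡ proj₁ (δ v))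
               × (proj₁ (δ u) ≡ proj₁ (δ v) → proj₁ u ≡ proj₁ v))

InΦF : ∀ {n} {I : Set} → (I → Subgraph n) → (V n → V n) → Set
InΦF {I = I} fac δ = InΦ δ
  × (∀ (i : I) → ∃[ j ] SameEdges (img δ (fac i)) (fac j))
  × (∀ (j : I) → ∃[ i ] SameEdges (img δ (fac i)) (fac j))

-- Conjugation  h = f̄⁻¹ δ̄ f̄  for a bijection f : S → F.
-- On R ∪ C, h acts as δ; on S, h s = s' where f s' = δ(f s) (δ̄ acting on F).

IsConj : ∀ {n} {I : Set} → (I → Subgraph n) → (Fin n ↔ I)
       → (V n → V n) → (Pt n → Pt n) → Set
IsConj {n} fac f δ h =
    (∀ (v : V n) → h (inj₁ v) ≡ inj₁ (δ v))
  × (∀ (s : Fin n) → ∃[ s' ] h (inj₂ s) ≡ inj₂ s'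
        × SameEdges (img δ (fac (Inverse.to f s))) (fac (Inverse.to f s')))

-- (F, f) agrees with Π :  { f̄⁻¹ δ̄ f̄ | δ ∈ Δ } = Π
Agrees : ∀ {n} {I : Set} → (I → Subgraph n) → Perm (Pt n) → (Fin n ↔ I) → Set
Agrees fac π f =
    (∀ δ → InΔ π δ → ∃[ h ] IsConj fac f δ h × InΠ π h)
  × (∀ h → InΠ π h → ∃[ δ ] InΔ π δ × IsConj fac f δ h)

Compatible : ∀ {n} {I : Set} → (I → Subgraph n) → Perm (Pt n) → Set
Compatible {n} {I} fac π = ∃[ f ] Agrees {n} {I} fac π f

InΨ : ∀ {n} → Perm (Pt n) → Set
InΨ {n} ψ = ∀ (v : V n) → Inverse.to ψ (inj₁ v) ≡ inj₁ v

NormΠ : ∀ {n} → Perm (Pt n) → Perm (Pt n) → Set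
NormΠ π ψ =
    (∀ g → InΠ π g → InΠ π (λ x → Inverse.to ψ (g (Inverse.from ψ x))))
  × (∀ h → InΠ π h → ∃[ g ] InΠ π g
        × (∀ x → h x ≡ Inverse.to ψ (g (Inverse.from ψ x))))

-- The setoid of bijections A → B satisfying P, with pointwise equality.
-- "exactly as many" is expressed by a bijection (Inverse) of such setoids.

ΣPermSetoid : (A B : Set) → ((A ↔ B) → Set) → Setoid 0ℓ 0ℓ
ΣPermSetoid A B P = record
  { Carrier = Σ (A ↔ B) P
  ; _≈_ = λ f g → ∀ x → Inverse.to (proj₁ f) x ≡ Inverse.to (proj₁ g) x
  ; isEquivalence = record
      { refl = λ x → refl
      ; sym = λ p x → sym (p x)
      ; trans = λ p q x → trans (p x) (q x) } }

module Submission where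

-- Write π for the involution generating Π.  As π fixes S setwise and is an
-- involution, it splits as δπ on R ∪ C and σπ on S.  The proof runs through
-- three general facts.
--   * Agreement.  (F, f) agrees with Π iff f intertwines σπ with the action of
--     δπ on the factors: δπ(f s) = f(σπ s) for every s ∈ S.
--   * Translation.  Since the factors of F are pairwise distinct, the action
--     of δπ on F is a function, so once one agreeing f₀ is fixed (F is
--     compatible with Π), f ↦ f₀⁻¹ ∘ f is a bijection from the agreeing f onto
--     the centralizer of σπ in Sym(S).
--   * Normalizer.  Ψ ≅ Sym(S) by restriction to S, and as π ≠ id, ψ ∈ Ψ
--     normalizes Π = {id, π} iff it commutes with π, i.e. iff its restriction
--     to S commutes with σπ.
-- Composing the two resulting bijections of setoids gives the theorem.

open import Defs
open import Level using (0ℓ)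
open import Relation.Binary.Bundles using (Setoid)
open import Data.Nat using (ℕ)
open import Data.Fin using (Fin)
open import Data.Product using (_×_; ∃-syntax; _,_; proj₁; proj₂)
open import Data.Sum using (_⊎_; inj₁; inj₂)
open import Data.Sum.Properties using (inj₁-injective; inj₂-injective)
open import Data.Empty using (⊥-elim)
open import Relation.Binary.PropositionalEquality
open import Relation.Nullary using (¬_)
open import Function.Bundles using (Inverse; _↔_; mk↔ₛ′)
open import Function.Construct.Composition using (_↔-∘_)
open import Function.Construct.Symmetry using (↔-sym)
import Function.Construct.Composition as Compose

open Inverse using (to; from; strictlyInverseˡ; strictlyInverseʳ)

Commute : {A : Set} → (A → A) → (A → A) → Set
Commute g h = ∀ x → g (h x) ≡ h (g x)

translationInverse : {A B : Set} (f₀ : A ↔ B) (P : A ↔ B → Set) (Q : Perm A → Set)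
  → (∀ f → P f → Q (↔-sym f₀ ↔-∘ f))
  → (∀ a → Q a → P (f₀ ↔-∘ a))
  → Inverse (ΣPermSetoid A B P) (ΣPermSetoid A A Q)
translationInverse f₀ P Q P⇒Q Q⇒P = record
  { to        = λ (f , p) → ↔-sym f₀ ↔-∘ f , P⇒Q f p
  ; from      = λ (a , q) → f₀ ↔-∘ a , Q⇒P a q
  ; to-cong   = λ f≗g x → cong (from f₀) (f≗g x)
  ; from-cong = λ a≗b x → cong (to f₀) (a≗b x)
  ; inverse   = (λ {a} {f} f≗ x → trans (cong (from f₀) (f≗ x))
                                        (strictlyInverseʳ f₀ (to (proj₁ a) x)))
              , (λ {f} {a} a≗ x → trans (cong (to f₀) (a≗ x))
                                        (strictlyInverseˡ f₀ (to (proj₁ f) x)))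
  }

module _ {X A : Set} where

  -- ψ fixes the left summand pointwise (for X ⊎ A = (R ∪ C) ⊎ S this is Ψ)
  FixesLeft : Perm (X ⊎ A) → Set
  FixesLeft ψ = ∀ x → to ψ (inj₁ x) ≡ inj₁ x

  inj₁≢inj₂ : ∀ {x : X} {a : A} → inj₁ x ≢ inj₂ a
  inj₁≢inj₂ ()

  fromLeft : (y : X ⊎ A) → (∀ a → y ≢ inj₂ a) → ∃[ x ] y ≡ inj₁ x
  fromLeft (inj₁ x) _   = x , refl
  fromLeft (inj₂ a) y≢ = ⊥-elim (y≢ a refl)

  fromRight : (y : X ⊎ A) → (∀ x → y ≢ inj₁ x) → ∃[ a ] y ≡ inj₂ a
  fromRight (inj₁ x) y≢ = ⊥-elim (y≢ x refl)
  fromRight (inj₂ a) _   = a , refl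

  involutionKeepsLeft : (g : X ⊎ A → X ⊎ A) → (∀ y → g (g y) ≡ y)
    → (∀ a → ∃[ b ] g (inj₂ a) ≡ inj₂ b)
    → ∀ x → ∃[ x' ] g (inj₁ x) ≡ inj₁ x'
  involutionKeepsLeft g invol keepsA x = fromLeft (g (inj₁ x)) λ a e →
    let (b , gb) = keepsA a
    in inj₁≢inj₂ (trans (sym (invol (inj₁ x))) (trans (cong g e) gb))

  fixesLeftKeepsRight : (ψ : Perm (X ⊎ A)) → FixesLeft ψ
    → ∀ a → ∃[ b ] to ψ (inj₂ a) ≡ inj₂ b
  fixesLeftKeepsRight ψ fix a = fromRight (to ψ (inj₂ a)) λ x e →
    inj₁≢inj₂ (sym (begin
      inj₂ a                      ≡⟨ strictlyInverseʳ ψ (inj₂ a) ⟨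
      from ψ (to ψ (inj₂ a))      ≡⟨ cong (from ψ) (trans e (sym (fix x))) ⟩
      from ψ (to ψ (inj₁ x))      ≡⟨ strictlyInverseʳ ψ (inj₁ x) ⟩
      inj₁ x                      ∎))
    where open ≡-Reasoning

  inverseFixesLeft : (ψ : Perm (X ⊎ A)) → FixesLeft ψ → FixesLeft (↔-sym ψ)
  inverseFixesLeft ψ fix x =
    trans (cong (from ψ) (sym (fix x))) (strictlyInverseʳ ψ (inj₁ x))

  restrictRight : (ψ : Perm (X ⊎ A)) → FixesLeft ψ → Perm A
  restrictRight ψ fix = mk↔ₛ′ (λ a → proj₁ (forth a)) (λ a → proj₁ (back a))
      (λ a → inj₂-injective (inverseOn ψ⁻¹ ψ back forth (strictlyInverseˡ ψ) a))
      (λ a → inj₂-injective (inverseOn ψ ψ⁻¹ forth back (strictlyInverseʳ ψ) a))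
    where
    ψ⁻¹ : Perm (X ⊎ A)
    ψ⁻¹ = ↔-sym ψ
    forth : ∀ a → ∃[ b ] to ψ (inj₂ a) ≡ inj₂ b
    forth = fixesLeftKeepsRight ψ fix
    back : ∀ a → ∃[ b ] from ψ (inj₂ a) ≡ inj₂ b
    back = fixesLeftKeepsRight ψ⁻¹ (inverseFixesLeft ψ fix)
    inverseOn : (g h : Perm (X ⊎ A)) (gA : ∀ a → ∃[ b ] to g (inj₂ a) ≡ inj₂ b)
      (hA : ∀ a → ∃[ b ] to h (inj₂ a) ≡ inj₂ b) → (∀ y → to h (to g y) ≡ y)
      → ∀ a → inj₂ (proj₁ (hA (proj₁ (gA a)))) ≡ inj₂ a
    inverseOn g h gA hA hg a =
      trans (sym (proj₂ (hA _))) (trans (cong (to h) (sym (proj₂ (gA a)))) (hg (inj₂ a)))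

  restrictRight-spec : (ψ : Perm (X ⊎ A)) (fix : FixesLeft ψ)
    → ∀ a → to ψ (inj₂ a) ≡ inj₂ (to (restrictRight ψ fix) a)
  restrictRight-spec ψ fix a = proj₂ (fixesLeftKeepsRight ψ fix a)

  extendRight : Perm A → Perm (X ⊎ A)
  extendRight a = mk↔ₛ′ (lift (to a)) (lift (from a))
      (section (to a) (from a) (strictlyInverseˡ a))
      (section (from a) (to a) (strictlyInverseʳ a))
    where
    lift : (A → A) → X ⊎ A → X ⊎ A
    lift g (inj₁ x) = inj₁ x
    lift g (inj₂ b) = inj₂ (g b)
    section : (g h : A → A) → (∀ b → g (h b) ≡ b) → ∀ y → lift g (lift h y) ≡ y
    section g h gh (inj₁ x) = refl
    section g h gh (inj₂ b) = cong inj₂ (gh b)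

  restrictionInverse : (P : Perm (X ⊎ A) → Set) (Q : Perm A → Set)
    → (∀ ψ (fix : FixesLeft ψ) → P ψ → Q (restrictRight ψ fix))
    → (∀ a → Q a → P (extendRight a))
    → Inverse (ΣPermSetoid A A Q) (ΣPermSetoid (X ⊎ A) (X ⊎ A) (λ ψ → FixesLeft ψ × P ψ))
  restrictionInverse P Q P⇒Q Q⇒P = record
    { to        = λ (a , q) → extendRight a , (λ x → refl) , Q⇒P a q
    ; from      = λ (ψ , fix , p) → restrictRight ψ fix , P⇒Q ψ fix p
    ; to-cong   = λ { a≗b (inj₁ x) → refl ; a≗b (inj₂ b) → cong inj₂ (a≗b b) }
    ; from-cong = λ { {ψ , fix , _} {φ , fix′ , _} ψ≗φ a → inj₂-injective
        (trans (sym (restrictRight-spec ψ fix a))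
               (trans (ψ≗φ (inj₂ a)) (restrictRight-spec φ fix′ a))) }
    ; inverse   = (λ { {ψ , fix , _} a≗ (inj₁ x) → sym (fix x)
                     ; {ψ , fix , _} a≗ (inj₂ b) →
                         trans (cong inj₂ (a≗ b)) (sym (restrictRight-spec ψ fix b)) })
                , (λ { {a , _} {ψ , fix , _} ψ≗ b → inj₂-injective
                         (trans (sym (restrictRight-spec ψ fix b)) (ψ≗ (inj₂ b))) })
    }

module _ {n : ℕ} where

  SameEdges-sym : {H K : Subgraph n} → SameEdges H K → SameEdges K H
  SameEdges-sym p r c = proj₂ (p r c) , proj₁ (p r c)

  SameEdges-trans : {H K L : Subgraph n} → SameEdges H K → SameEdges K L → SameEdges H L
  SameEdges-trans p q r c = (λ h → proj₁ (q r c) (proj₁ (p r c) h))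
                          , (λ l → proj₂ (p r c) (proj₂ (q r c) l))

  img-cong : (δ δ′ : V n → V n) → (∀ v → δ v ≡ δ′ v) → (H : Subgraph n)
    → SameEdges (img δ H) (img δ′ H)
  img-cong δ δ′ δ≗δ′ H r c = transport δ δ′ δ≗δ′
                           , transport δ′ δ (λ v → sym (δ≗δ′ v))
    where
    transport : (δ δ′ : V n → V n) → (∀ v → δ v ≡ δ′ v) → img δ H r c → img δ′ H r c
    transport δ δ′ e (r₀ , c₀ , h , inj₁ (p , q)) =
      r₀ , c₀ , h , inj₁ (trans (sym (e _)) p , trans (sym (e _)) q)
    transport δ δ′ e (r₀ , c₀ , h , inj₂ (p , q)) =
      r₀ , c₀ , h , inj₂ (trans (sym (e _)) p , trans (sym (e _)) q)

  img-id : (δ : V n → V n) → (∀ v → δ v ≡ v) → (H : Subgraph n) → SameEdges (img δ H) H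
  img-id δ δ≗id H r c = forth , λ h → r , c , h , inj₁ (δ≗id _ , δ≗id _)
    where
    forth : img δ H r c → H r c
    forth (r₀ , c₀ , h , inj₁ (p , q))
      with trans (sym (δ≗id _)) p | trans (sym (δ≗id _)) q
    ... | refl | refl = h
    forth (r₀ , c₀ , h , inj₂ (p , q)) with trans (sym (δ≗id _)) p
    ... | ()

  module _ {I : Set} (fac : I → Subgraph n) where

    MapsFactor : (V n → V n) → I → I → Set
    MapsFactor δ i j = SameEdges (img δ (fac i)) (fac j)

    Intertwines : (V n → V n) → (Fin n → Fin n) → Fin n ↔ I → Set
    Intertwines δ σ f = ∀ s → MapsFactor δ (to f s) (to f (σ s))

    module _ (distinct : ∀ i j → SameEdges (fac i) (fac j) → i ≡ j) where

      mapsFactor-unique : ∀ {δ i j j′} → MapsFactor δ i j → MapsFactor δ i j′ → j ≡ j′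
      mapsFactor-unique t t′ = distinct _ _ (SameEdges-trans (SameEdges-sym t) t′)

      intertwiners-differ-by-commuting : ∀ {δ σ} (f₀ f : Fin n ↔ I)
        → Intertwines δ σ f₀ → Intertwines δ σ f → Commute (to (↔-sym f₀ ↔-∘ f)) σ
      intertwiners-differ-by-commuting {δ} {σ} f₀ f int₀ int s =
        trans (cong (from f₀) f-σs≡) (strictlyInverseʳ f₀ _)
        where
        τs : Fin n
        τs = from f₀ (to f s)
        f-σs≡ : to f (σ s) ≡ to f₀ (σ τs)
        f-σs≡ = mapsFactor-unique {δ} (int s)
          (subst (λ i → MapsFactor δ i (to f₀ (σ τs))) (strictlyInverseˡ f₀ (to f s)) (int₀ τs))

    intertwines-∘-commuting : ∀ {δ σ} (f₀ : Fin n ↔ I) (a : Perm (Fin n))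
      → Intertwines δ σ f₀ → Commute (to a) σ → Intertwines δ σ (f₀ ↔-∘ a)
    intertwines-∘-commuting {δ} f₀ a int₀ comm s =
      subst (λ t → MapsFactor δ (to f₀ (to a s)) (to f₀ t)) (sym (comm s)) (int₀ (to a s))

  module Involution (π : Perm (Pt n)) (involutive : ∀ x → to π (to π x) ≡ x)
                    (fixS : FixesS (to π)) where

    -- the parts of π on S and on R ∪ C (the latter exists as π² = id)
    σπ : Fin n → Fin n
    σπ s = proj₁ (proj₁ fixS s)

    σπ-spec : ∀ s → to π (inj₂ s) ≡ inj₂ (σπ s)
    σπ-spec s = proj₂ (proj₁ fixS s)

    δπ : V n → V n
    δπ v = proj₁ (involutionKeepsLeft (to π) involutive (proj₁ fixS) v)

    δπ-spec : ∀ v → to π (inj₁ v) ≡ inj₁ (δπ v)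
    δπ-spec v = proj₂ (involutionKeepsLeft (to π) involutive (proj₁ fixS) v)

    restriction-unique : {δ : V n → V n} → (∀ v → to π (inj₁ v) ≡ inj₁ (δ v))
      → ∀ v → δπ v ≡ δ v
    restriction-unique πδ v = inj₁-injective (trans (sym (δπ-spec v)) (πδ v))

    module Agreement {I : Set} (fac : I → Subgraph n) (f : Fin n ↔ I) where

      -- id ∈ Δ conjugates to id ∈ Π, and δπ ∈ Δ to π
      intertwines⇒agrees : Intertwines fac δπ σπ f → Agrees fac π f
      intertwines⇒agrees int = conjugates , conjugated
        where
        conjugates : ∀ δ → InΔ π δ → ∃[ h ] IsConj fac f δ h × InΠ π h
        conjugates δ (g , inj₁ g≗id , gδ) =
          (λ x → x) , ((λ v → cong inj₁ (sym (δ≗id v)))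
                      , (λ s → s , refl , img-id δ δ≗id (fac (to f s))))
                    , inj₁ (λ _ → refl)
          where
          δ≗id : ∀ v → δ v ≡ v
          δ≗id v = sym (inj₁-injective (trans (sym (g≗id (inj₁ v))) (gδ v)))
        conjugates δ (g , inj₂ g≗π , gδ) =
          to π , (πδ , (λ s → σπ s , σπ-spec s
                      , SameEdges-trans (img-cong δ δπ (λ v → sym (restriction-unique πδ v)) _)
                                        (int s)))
               , inj₂ (λ _ → refl)
          where
          πδ : ∀ v → to π (inj₁ v) ≡ inj₁ (δ v)
          πδ v = trans (sym (g≗π (inj₁ v))) (gδ v)
        conjugated : ∀ h → InΠ π h → ∃[ δ ] InΔ π δ × IsConj fac f δ h
        conjugated h (inj₁ h≗id) =
          (λ v → v) , ((λ x → x) , inj₁ (λ _ → refl) , (λ v → refl))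
                    , (λ v → h≗id (inj₁ v))
                    , (λ s → s , h≗id (inj₂ s) , img-id (λ v → v) (λ _ → refl) (fac (to f s)))
        conjugated h (inj₂ h≗π) =
          δπ , (to π , inj₂ (λ _ → refl) , δπ-spec)
             , (λ v → trans (h≗π _) (δπ-spec v))
             , (λ s → σπ s , trans (h≗π _) (σπ-spec s) , int s)

      -- π ∈ Π must be the conjugate of some δ ∈ Δ, which can only be δπ
      agrees⇒intertwines : Agrees fac π f → Intertwines fac δπ σπ f
      agrees⇒intertwines (_ , conjugated) s
        with conjugated (to π) (inj₂ (λ _ → refl))
      ... | δ , _ , (πδ , onS) with onS s
      ... | s′ , πs≡s′ , δ-maps =
        SameEdges-trans (img-cong δπ δ (restriction-unique πδ) (fac (to f s)))
                        (subst (λ t → MapsFactor fac δ (to f s) (to f t)) s′≡σπs δ-maps)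
        where
        s′≡σπs : s′ ≡ σπ s
        s′≡σπs = inj₂-injective (trans (sym πs≡s′) (σπ-spec s))

    module RestrictionToS (ψ : Perm (Pt n)) (fix : FixesLeft ψ) (a : Perm (Fin n))
                     (ψ-on-S : ∀ s → to ψ (inj₂ s) ≡ inj₂ (to a s)) where

      commutesWithπ⇒commutes : Commute (to ψ) (to π) → Commute (to a) σπ
      commutesWithπ⇒commutes ψπ≡πψ s = inj₂-injective (begin
        inj₂ (to a (σπ s))      ≡⟨ ψ-on-S (σπ s) ⟨
        to ψ (inj₂ (σπ s))      ≡⟨ cong (to ψ) (σπ-spec s) ⟨
        to ψ (to π (inj₂ s))    ≡⟨ ψπ≡πψ (inj₂ s) ⟩
        to π (to ψ (inj₂ s))    ≡⟨ cong (to π) (ψ-on-S s) ⟩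
        to π (inj₂ (to a s))    ≡⟨ σπ-spec (to a s) ⟩
        inj₂ (σπ (to a s))      ∎)
        where open ≡-Reasoning

      commutes⇒commutesWithπ : Commute (to a) σπ → Commute (to ψ) (to π)
      commutes⇒commutesWithπ comm (inj₁ v) = begin
        to ψ (to π (inj₁ v))    ≡⟨ cong (to ψ) (δπ-spec v) ⟩
        to ψ (inj₁ (δπ v))      ≡⟨ fix (δπ v) ⟩
        inj₁ (δπ v)             ≡⟨ δπ-spec v ⟨
        to π (inj₁ v)           ≡⟨ cong (to π) (fix v) ⟨
        to π (to ψ (inj₁ v))    ∎
        where open ≡-Reasoning
      commutes⇒commutesWithπ comm (inj₂ s) = begin
        to ψ (to π (inj₂ s))    ≡⟨ cong (to ψ) (σπ-spec s) ⟩
        to ψ (inj₂ (σπ s))      ≡⟨ ψ-on-S (σπ s) ⟩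
        inj₂ (to a (σπ s))      ≡⟨ cong inj₂ (comm s) ⟩
        inj₂ (σπ (to a s))      ≡⟨ σπ-spec (to a s) ⟨
        to π (inj₂ (to a s))    ≡⟨ cong (to π) (ψ-on-S s) ⟨
        to π (to ψ (inj₂ s))    ∎
        where open ≡-Reasoning

  -- ψ normalizes Π = {id, π} iff ψ commutes with π (the conjugate of π ≠ id is not id)
  module Normalizer (π : Perm (Pt n)) (nontrivial : ¬ (∀ x → to π x ≡ x))
                    (ψ : Perm (Pt n)) where

    conjugate : (Pt n → Pt n) → Pt n → Pt n
    conjugate g x = to ψ (g (from ψ x))

    conjugate⇒intertwined : (g k : Pt n → Pt n) → (∀ x → conjugate g x ≡ k x)
      → ∀ y → to ψ (g y) ≡ k (to ψ y)
    conjugate⇒intertwined g k ψgψ⁻¹≡k y =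
      trans (cong (λ z → to ψ (g z)) (sym (strictlyInverseʳ ψ y))) (ψgψ⁻¹≡k (to ψ y))

    commutes⇒conjugate-π : Commute (to ψ) (to π)
      → ∀ x → conjugate (to π) x ≡ to π x
    commutes⇒conjugate-π ψπ≡πψ x =
      trans (ψπ≡πψ (from ψ x)) (cong (to π) (strictlyInverseˡ ψ x))

    normalizes⇒commutes : NormΠ π ψ → Commute (to ψ) (to π)
    normalizes⇒commutes (maps , _) with maps (to π) (inj₂ (λ _ → refl))
    ... | inj₂ ψπψ⁻¹≡π = conjugate⇒intertwined (to π) (to π) ψπψ⁻¹≡π
    ... | inj₁ ψπψ⁻¹≡id = ⊥-elim (nontrivial λ y → begin
      to π y                  ≡⟨ strictlyInverseʳ ψ (to π y) ⟨
      from ψ (to ψ (to π y))  ≡⟨ cong (from ψ) (ψπ≡ψ y) ⟩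
      from ψ (to ψ y)         ≡⟨ strictlyInverseʳ ψ y ⟩
      y                       ∎)
      where
      open ≡-Reasoning
      ψπ≡ψ : ∀ y → to ψ (to π y) ≡ to ψ y
      ψπ≡ψ = conjugate⇒intertwined (to π) (λ x → x) ψπψ⁻¹≡id

    commutes⇒normalizes : Commute (to ψ) (to π) → NormΠ π ψ
    commutes⇒normalizes ψπ≡πψ = maps , covers
      where
      ψπψ⁻¹≡π : ∀ x → conjugate (to π) x ≡ to π x
      ψπψ⁻¹≡π = commutes⇒conjugate-π ψπ≡πψ
      maps : ∀ g → InΠ π g → InΠ π (conjugate g)
      maps g (inj₁ g≗id) = inj₁ λ x → trans (cong (to ψ) (g≗id _)) (strictlyInverseˡ ψ x)
      maps g (inj₂ g≗π)  = inj₂ λ x → trans (cong (to ψ) (g≗π _)) (ψπψ⁻¹≡π x)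
      covers : ∀ h → InΠ π h → ∃[ g ] InΠ π g × (∀ x → h x ≡ conjugate g x)
      covers h (inj₁ h≗id) = (λ x → x) , inj₁ (λ _ → refl)
                           , λ x → trans (h≗id x) (sym (strictlyInverseˡ ψ x))
      covers h (inj₂ h≗π)  = to π , inj₂ (λ _ → refl)
                           , λ x → trans (h≗π x) (sym (ψπψ⁻¹≡π x))

lemma4p3 : (n : ℕ) (π : Perm (Pt n))
    → InΓ (Inverse.to π)
    → (∀ x → Inverse.to π (Inverse.to π x) ≡ x)
    → ¬ (∀ x → Inverse.to π x ≡ x)
    → FixesS (Inverse.to π)
    → (I : Set) (fac : I → Subgraph n)
    → IsOneFactorization fac
    → (∀ δ → InΔ π δ → InΦF fac δ)
    → Compatible fac π
    → Inverse (ΣPermSetoid (Fin n) I (Agrees fac π))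
    (ΣPermSetoid (Pt n) (Pt n) (λ ψ → InΨ ψ × NormΠ π ψ))
lemma4p3 n π _ involutive nontrivial fixS I fac (_ , _ , distinct) _ (f₀ , agrees₀) =
  Compose.inverse agreeing≅centralizer centralizer≅normalizer
  where
  open Involution π involutive fixS
  open Agreement fac using (agrees⇒intertwines; intertwines⇒agrees)
  int₀ : Intertwines fac δπ σπ f₀
  int₀ = agrees⇒intertwines f₀ agrees₀

  Centralizer : Setoid 0ℓ 0ℓ
  Centralizer = ΣPermSetoid (Fin n) (Fin n) (λ a → Commute (to a) σπ)

  agreeing≅centralizer : Inverse (ΣPermSetoid (Fin n) I (Agrees fac π)) Centralizer
  agreeing≅centralizer = translationInverse f₀ (Agrees fac π) (λ a → Commute (to a) σπ)
    (λ f agrees → intertwiners-differ-by-commuting fac distinct {δπ} f₀ f int₀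
                    (agrees⇒intertwines f agrees))
    (λ a comm → intertwines⇒agrees (f₀ ↔-∘ a) (intertwines-∘-commuting fac {δπ} f₀ a int₀ comm))

  centralizer≅normalizer :
    Inverse Centralizer (ΣPermSetoid (Pt n) (Pt n) (λ ψ → InΨ ψ × NormΠ π ψ))
  centralizer≅normalizer = restrictionInverse (NormΠ π) (λ a → Commute (to a) σπ)
    (λ ψ fix norm → RestrictionToS.commutesWithπ⇒commutes ψ fix (restrictRight ψ fix)
                      (restrictRight-spec ψ fix) (Normalizer.normalizes⇒commutes π nontrivial ψ norm))
    (λ a comm → Normalizer.commutes⇒normalizes π nontrivial (extendRight a)
                  (RestrictionToS.commutes⇒commutesWithπ (extendRight a) (λ _ → refl) a (λ _ → refl) comm))
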